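{- Let $\lambda/\mu$, $\nu/\rho$ be skew shapes, $D$ the shuffle diagram of shape $(\lambda/\mu)\circledast(\nu/\rho)$, and $T$ a $D$-compatible standard Young tableau. Then $\varphi(T)$ is a shuffle tableau of shape $(\lambda/\mu)\circledast(\nu/\rho)$.
   Context: English convention: $(i,j)$ is row $i$ (top to bottom), column $j$; North = up, East = right. The shuffle diagram $D$ has a square at $(2i-1,2j-1)$ for each square $(i,j)$ of $\lambda/\mu$ and at $(2i,2j)$ for each square $(i,j)$ of $\nu/\rho$. A shuffle tableau of this shape is a filling of $D$ by positive integers weakly increasing along each row of $D$ and strictly increasing down each column of $D$. Label the $N$ squares of $D$ by $1,\ldots,N$ row by row from the top row to the bottom row, within each row from right to left. A standard Young tableau $T$ with entries $1,\ldots,N$ is $D$-compatible if: (1) whenever squares $i+1$ and $i$ lie in the same row of $D$, the entry $i+1$ lies in $T$ in a row weakly above and a column strictly to the right of the entry $i$; (2) whenever square $i$ is at $(r,c)$ and square $j$ at $(r+2,c)$ in $D$, the entry $i$ lies in $T$ in a row strictly above and a column weakly to the right of the entry $j$. $\varphi(T)$ is the filling of $D$ in which square $i$ receives the index of the row of $T$ containing $i$. -}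

module Defs where

open import Data.Nat using (ℕ; zero; suc; _+_; _*_; _∸_; _≤_; _<_; _⊔_; _<?_)
open import Data.Product using (Σ; ∃; _×_; _,_; proj₁; proj₂)
open import Data.List using (List; []; _∷_; _++_; map; filter; downFrom; upTo; concatMap; length)
open import Data.Maybe using (Maybe; just; nothing)
open import Relation.Binary.PropositionalEquality using (_≡_)

-- Conventions: rows and columns are indexed from 1 (row 1 = top row).

-- A partition / shape is given by its list of row lengths;
-- len l i is the length of row i (1-indexed), and 0 for i = 0 or i > length l.
len : List ℕ → ℕ → ℕ
len []       _             = 0
len (x ∷ xs) zero          = 0
len (x ∷ xs) (suc zero)    = x
len (x ∷ xs) (suc (suc i)) = len xs (suc i)

IsPartition : List ℕ → Set
IsPartition l = ∀ i → 1 ≤ i → len l (suc i) ≤ len l i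

_⊆ₚ_ : List ℕ → List ℕ → Set
mu ⊆ₚ la = ∀ i → len mu i ≤ len la i

IsSkewShape : List ℕ → List ℕ → Set
IsSkewShape la mu = IsPartition la × IsPartition mu × (mu ⊆ₚ la)

InShape : List ℕ → ℕ × ℕ → Set
InShape kappa (r , c) = 1 ≤ r × 1 ≤ c × c ≤ len kappa r

colsDesc : ℕ → ℕ → List ℕ
colsDesc lo hi = filter (lo <?_) (map suc (downFrom hi))

-- The squares of the shuffle diagram D of (la/mu) ⊛ (nu/rho), listed in the
-- labelling order: row by row from top to bottom, within each row right to left.
shuffleDiagram : List ℕ → List ℕ → List ℕ → List ℕ → List (ℕ × ℕ)
shuffleDiagram la mu nu rho =
  concatMap (λ i →
      map (λ j → (2 * i ∸ 1 , 2 * j ∸ 1)) (colsDesc (len mu i) (len la i))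
   ++ map (λ j → (2 * i , 2 * j)) (colsDesc (len rho i) (len nu i)))
    (map suc (upTo (length la ⊔ length nu)))

-- 1-indexed lookup: sq D k ≡ just p  means "square k of D is at position p"
sq : List (ℕ × ℕ) → ℕ → Maybe (ℕ × ℕ)
sq []       _             = nothing
sq (x ∷ xs) zero          = nothing
sq (x ∷ xs) (suc zero)    = just x
sq (x ∷ xs) (suc (suc k)) = sq xs (suc k)

-- A standard Young tableau of (straight) shape kappa with entries 1..N,
-- encoded by the map  pos : entry ↦ (row , column) of the cell containing it.
record SYT (kappa : List ℕ) (N : ℕ) : Set where
  field
    shapePartition : IsPartition kappa
    pos     : ℕ → ℕ × ℕ
    posIn   : ∀ k → 1 ≤ k → k ≤ N → InShape kappa (pos k)
    posInj  : ∀ a b → 1 ≤ a → a ≤ N → 1 ≤ b → b ≤ N → pos a ≡ pos b → a ≡ b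
    posSurj : ∀ p → InShape kappa p → Σ ℕ (λ k → 1 ≤ k × k ≤ N × pos k ≡ p)
    rowInc  : ∀ a b r c → 1 ≤ a → a ≤ N → 1 ≤ b → b ≤ N →
              pos a ≡ (r , c) → pos b ≡ (r , suc c) → a < b
    colInc  : ∀ a b r c → 1 ≤ a → a ≤ N → 1 ≤ b → b ≤ N →
              pos a ≡ (r , c) → pos b ≡ (suc r , c) → a < b

  rowOf : ℕ → ℕ
  rowOf k = proj₁ (pos k)

  colOf : ℕ → ℕ
  colOf k = proj₂ (pos k)

open SYT public

Compatible : ∀ {kappa N} → List (ℕ × ℕ) → SYT kappa N → Set
Compatible D T =
  (∀ i r c c' → sq D (suc i) ≡ just (r , c) → sq D i ≡ just (r , c') →
     rowOf T (suc i) ≤ rowOf T i × colOf T i < colOf T (suc i))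
  × (∀ i j r c → sq D i ≡ just (r , c) → sq D j ≡ just (2 + r , c) →
     rowOf T i < rowOf T j × colOf T j ≤ colOf T i)

-- A filling of D is given by f : label ↦ entry of that square.
-- Shuffle tableau: positive entries, weakly increasing along each row of D,
-- strictly increasing down each column of D.
IsShuffleTableau : List (ℕ × ℕ) → (ℕ → ℕ) → Set
IsShuffleTableau D f =
  (∀ k p → sq D k ≡ just p → 1 ≤ f k)
  × (∀ k k' r c c' → sq D k ≡ just (r , c) → sq D k' ≡ just (r , c') →
       c < c' → f k ≤ f k')
  × (∀ k k' r r' c → sq D k ≡ just (r , c) → sq D k' ≡ just (r' , c) →
       r < r' → f k < f k')

φ : ∀ {kappa N} → SYT kappa N → ℕ → ℕ
φ T i = rowOf T i

module Submission where

-- Squares in a row of D carry consecutive labels, decreasing from left to right, so chaining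
-- condition (1) of compatibility along the row shows that φ(T) weakly increases along it.
-- Squares in a column of D lie two rows apart with no gaps: λ/μ occupies the odd and ν/ρ the even
-- rows and columns of D, and a skew shape is convex in each column. Chaining condition (2) down
-- the column then shows that φ(T) strictly increases down it.

open import Defs
open import Data.Nat using (ℕ; zero; suc; _+_; _*_; _∸_; _≤_; _<_; _>_; _⊔_; z≤n; s≤s; z<s)
open import Data.Nat.Properties
open import Data.Product using (∃; _×_; _,_; proj₁; proj₂)
open import Data.Sum using (_⊎_; inj₁; inj₂)
open import Data.Empty using (⊥-elim)
open import Function using (case_of_)
open import Data.List using (List; _∷_; _++_; length; map; downFrom; upTo)
open import Data.Maybe using (just)
open import Data.Maybe.Properties using (just-injective)
open import Relation.Binary.PropositionalEquality using (_≡_; _≢_; refl; sym; trans; cong; subst)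
open import Data.List.Membership.Propositional using (_∈_; find; lose)
open import Data.List.Membership.Propositional.Properties
open import Data.List.Relation.Unary.Any using (here; there)
open import Data.List.Relation.Unary.All as All using (All)
import Data.List.Relation.Unary.All.Properties as All
open import Data.List.Relation.Unary.AllPairs as AllPairs using (AllPairs; []; _∷_)
import Data.List.Relation.Unary.AllPairs.Properties as AllPairs

descending-steps⇒≤ : ∀ (f : ℕ → ℕ) {a b} → (∀ {m} → a ≤ m → m < b → f (suc m) ≤ f m) →
                     a ≤ b → f b ≤ f a
descending-steps⇒≤ f {b = zero} step z≤n = ≤-refl
descending-steps⇒≤ f {b = suc b} step a≤1+b with m≤n⇒m<n∨m≡n a≤1+b
... | inj₂ refl = ≤-refl
... | inj₁ (s≤s a≤b) =
  ≤-trans (step a≤b ≤-refl) (descending-steps⇒≤ f (λ a≤m m<b → step a≤m (m<n⇒m<1+n m<b)) a≤b)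

sq-bounds : ∀ (L : List (ℕ × ℕ)) {k p} → sq L k ≡ just p → 1 ≤ k × k ≤ length L
sq-bounds (_ ∷ _) {suc zero}    _  = s≤s z≤n , s≤s z≤n
sq-bounds (_ ∷ L) {suc (suc k)} eq = s≤s z≤n , s≤s (proj₂ (sq-bounds L eq))

sq-defined : ∀ (L : List (ℕ × ℕ)) {k} → 1 ≤ k → k ≤ length L → ∃ λ p → sq L k ≡ just p
sq-defined (q ∷ _) {suc zero}    _ _           = q , refl
sq-defined (_ ∷ L) {suc (suc k)} _ (s≤s k<len) = sq-defined L (s≤s z≤n) k<len

sq⇒∈ : ∀ (L : List (ℕ × ℕ)) {k p} → sq L k ≡ just p → p ∈ L
sq⇒∈ (_ ∷ _) {suc zero}    refl = here refl
sq⇒∈ (_ ∷ L) {suc (suc k)} eq   = there (sq⇒∈ L eq)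

∈⇒sq : ∀ {L : List (ℕ × ℕ)} {p} → p ∈ L → ∃ λ k → sq L (suc k) ≡ just p
∈⇒sq (here refl) = zero , refl
∈⇒sq (there p∈)  = let k , eq = ∈⇒sq p∈ in suc k , eq

sq-AllPairs : ∀ {R : ℕ × ℕ → ℕ × ℕ → Set} {L k k' p q} → AllPairs R L → k < k' →
              sq L k ≡ just p → sq L k' ≡ just q → R p q
sq-AllPairs []                                                  _          ()   _
sq-AllPairs {k = zero}                       (_ ∷ _)            _          ()   _
sq-AllPairs {k = suc zero}    {suc zero}     (_ ∷ _)            (s≤s ())   _    _
sq-AllPairs {k = suc zero}    {suc (suc k')} (R-first ∷ _)      _          refl eq' =
  All.lookup R-first (sq⇒∈ _ eq')
sq-AllPairs {k = suc (suc k)} {suc (suc k')} (_ ∷ R-rest)       (s≤s k<k') eq   eq' =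
  sq-AllPairs R-rest k<k' eq eq'

-- p may carry a smaller label than q: it lies in an earlier row, or in the same row weakly to the right.
Precedes : ℕ × ℕ → ℕ × ℕ → Set
Precedes (r , c) (r' , c') = r < r' ⊎ (r ≡ r' × c' ≤ c)

Precedes-refl : ∀ {p} → Precedes p p
Precedes-refl = inj₂ (refl , ≤-refl)

Precedes⇒row≤ : ∀ {p q} → Precedes p q → proj₁ p ≤ proj₁ q
Precedes⇒row≤ (inj₁ r<r')       = <⇒≤ r<r'
Precedes⇒row≤ (inj₂ (refl , _)) = ≤-refl

sq-Precedes : ∀ {D k k' p q} → AllPairs Precedes D → k ≤ k' →
              sq D k ≡ just p → sq D k' ≡ just q → Precedes p q
sq-Precedes sorted k≤k' eq eq' with m≤n⇒m<n∨m≡n k≤k'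
... | inj₁ k<k' = sq-AllPairs sorted k<k' eq eq'
... | inj₂ refl with just-injective (trans (sym eq) eq')
...   | refl = Precedes-refl

sq-between-same-row : ∀ {D k k' m r c c'} → AllPairs Precedes D →
                      sq D k ≡ just (r , c) → sq D k' ≡ just (r , c') → k ≤ m → m ≤ k' →
                      ∃ λ c'' → sq D m ≡ just (r , c'')
sq-between-same-row {D} {m = m} sorted eq eq' k≤m m≤k' =
  let (r'' , c'') , eqₘ = sq-defined D (≤-trans (proj₁ (sq-bounds D eq)) k≤m)
                                       (≤-trans m≤k' (proj₂ (sq-bounds D eq')))
      r≡r'' = ≤-antisym (Precedes⇒row≤ (sq-Precedes sorted k≤m eq eqₘ))
                        (Precedes⇒row≤ (sq-Precedes sorted m≤k' eqₘ eq'))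
  in  c'' , subst (λ x → sq D m ≡ just (x , c'')) (sym r≡r'') eqₘ

StridedColumns : List (ℕ × ℕ) → Set
StridedColumns D = ∀ {r r' c} → (r , c) ∈ D → (r' , c) ∈ D → r < r' → 2 + r ≤ r' × (2 + r , c) ∈ D

module _ {kappa : List ℕ} {D : List (ℕ × ℕ)} (T : SYT kappa (length D)) (compatible : Compatible D T) where

  φ-positive : ∀ k p → sq D k ≡ just p → 1 ≤ φ T k
  φ-positive k p eq = let 1≤k , k≤N = sq-bounds D eq in proj₁ (posIn T k 1≤k k≤N)

  φ-weakly-increasing-along-rows : AllPairs Precedes D →
    ∀ k k' r c c' → sq D k ≡ just (r , c) → sq D k' ≡ just (r , c') → c < c' → φ T k ≤ φ T k'
  φ-weakly-increasing-along-rows sorted k k' r c c' eq eq' c<c' =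
    descending-steps⇒≤ (rowOf T) step (<⇒≤ k'<k)
    where
      k'<k : k' < k
      k'<k = ≰⇒> λ k≤k' → case sq-Precedes sorted k≤k' eq eq' of λ where
        (inj₁ r<r)         → <-irrefl refl r<r
        (inj₂ (_ , c'≤c)) → <⇒≱ c<c' c'≤c
      step : ∀ {m} → k' ≤ m → m < k → rowOf T (suc m) ≤ rowOf T m
      step k'≤m m<k =
        let _ , eq₁ = sq-between-same-row sorted eq' eq (≤-trans k'≤m (n≤1+n _)) m<k
            _ , eq₀ = sq-between-same-row sorted eq' eq k'≤m (<⇒≤ m<k)
        in  proj₁ (proj₁ compatible _ r _ _ eq₁ eq₀)

  rowOf-increasing-down-column : StridedColumns D →
    ∀ g {k k' r c} → sq D k ≡ just (r , c) → sq D k' ≡ just (suc g + r , c) → rowOf T k < rowOf T k'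
  rowOf-increasing-down-column strided zero eq eq' =
    ⊥-elim (1+n≰n (proj₁ (strided (sq⇒∈ D eq) (sq⇒∈ D eq') ≤-refl)))
  rowOf-increasing-down-column strided 1 eq eq' = proj₁ (proj₂ compatible _ _ _ _ eq eq')
  rowOf-increasing-down-column strided (suc (suc g)) {k} {k'} {r} {c} eq eq' =
    let _ , eq₂ = ∈⇒sq (proj₂ (strided (sq⇒∈ D eq) (sq⇒∈ D eq') (s≤s (m≤n+m r (2 + g)))))
    in  <-trans (proj₁ (proj₂ compatible _ _ _ _ eq eq₂))
                (rowOf-increasing-down-column strided g eq₂
                  (subst (λ x → sq D k' ≡ just (x , c)) shift eq'))
    where
      shift : 3 + g + r ≡ suc g + (2 + r)
      shift = sym (cong suc (trans (+-suc g (suc r)) (cong suc (+-suc g r))))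

  φ-increasing-down-columns : StridedColumns D →
    ∀ k k' r r' c → sq D k ≡ just (r , c) → sq D k' ≡ just (r' , c) → r < r' → φ T k < φ T k'
  φ-increasing-down-columns strided k k' r r' c eq eq' r<r' =
    let g , 1+r+g≡r' = m≤n⇒∃[o]m+o≡n r<r'
    in  rowOf-increasing-down-column strided g eq
          (subst (λ x → sq D k' ≡ just (x , c)) (sym (trans (cong suc (+-comm g r)) 1+r+g≡r')) eq')

  compatible⇒shuffleTableau : AllPairs Precedes D → StridedColumns D → IsShuffleTableau D (φ T)
  compatible⇒shuffleTableau sorted strided =
    φ-positive , φ-weakly-increasing-along-rows sorted , φ-increasing-down-columns strided

len-antitone : ∀ {l} → IsPartition l → ∀ {m n} → 1 ≤ m → m ≤ n → len l n ≤ len l m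
len-antitone {l} isPartition 1≤m =
  descending-steps⇒≤ (len l) (λ m≤i _ → isPartition _ (≤-trans 1≤m m≤i))

InSkewShape : List ℕ → List ℕ → ℕ × ℕ → Set
InSkewShape la mu (i , j) = 1 ≤ i × len mu i < j × j ≤ len la i

InSkewShape⇒1≤col : ∀ {la mu i j} → InSkewShape la mu (i , j) → 1 ≤ j
InSkewShape⇒1≤col (_ , mu<j , _) = ≤-trans (s≤s z≤n) mu<j

InSkewShape-below : ∀ {la mu i i' j} → IsPartition la → IsPartition mu →
                    InSkewShape la mu (i , j) → InSkewShape la mu (i' , j) → i < i' →
                    InSkewShape la mu (suc i , j)
InSkewShape-below {la} {i = i} isPartition-la isPartition-mu (1≤i , mu<j , _) (_ , _ , j≤la) i<i' =
  s≤s z≤n ,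
  ≤-<-trans (isPartition-mu i 1≤i) mu<j ,
  ≤-trans j≤la (len-antitone {la} isPartition-la (s≤s z≤n) i<i')

0<len⇒≤length : ∀ l {i} → 0 < len l i → i ≤ length l
0<len⇒≤length (_ ∷ _) {zero}        _   = z≤n
0<len⇒≤length (_ ∷ _) {suc zero}    _   = s≤s z≤n
0<len⇒≤length (_ ∷ l) {suc (suc i)} pos = s≤s (0<len⇒≤length l pos)

InSkewShape⇒≤length : ∀ {la mu i j} → InSkewShape la mu (i , j) → i ≤ length la
InSkewShape⇒≤length {la} (_ , mu<j , j≤la) = 0<len⇒≤length la (<-≤-trans (≤-<-trans z≤n mu<j) j≤la)

δ≤2n : ∀ {δ n} → δ ≤ 1 → 1 ≤ n → δ ≤ 2 * n
δ≤2n {n = n} δ≤1 1≤n = ≤-trans δ≤1 (≤-trans 1≤n (m≤n*m n 2))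

2m∸δ≡2n∸δ⇒m≡n : ∀ {δ m n} → δ ≤ 1 → 1 ≤ m → 1 ≤ n → 2 * m ∸ δ ≡ 2 * n ∸ δ → m ≡ n
2m∸δ≡2n∸δ⇒m≡n {m = m} {n} δ≤1 1≤m 1≤n eq =
  *-cancelˡ-≡ m n 2 (∸-cancelʳ-≡ (δ≤2n δ≤1 1≤m) (δ≤2n δ≤1 1≤n) eq)

m≤n⇒2m∸δ≤2n∸δ : ∀ {δ m n} → m ≤ n → 2 * m ∸ δ ≤ 2 * n ∸ δ
m≤n⇒2m∸δ≤2n∸δ {δ} m≤n = ∸-monoˡ-≤ δ (*-monoʳ-≤ 2 m≤n)

2m∸δ<2n∸δ⇒m<n : ∀ {δ m n} → 2 * m ∸ δ < 2 * n ∸ δ → m < n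
2m∸δ<2n∸δ⇒m<n {δ} lt = ≰⇒> (λ n≤m → <⇒≱ lt (m≤n⇒2m∸δ≤2n∸δ {δ} n≤m))

2[1+n]∸δ≡2+[2n∸δ] : ∀ {δ n} → δ ≤ 2 * n → 2 * suc n ∸ δ ≡ 2 + (2 * n ∸ δ)
2[1+n]∸δ≡2+[2n∸δ] {δ} {n} δ≤2n = trans (cong (_∸ δ) (*-suc 2 n)) (+-∸-assoc 2 δ≤2n)

2m∸1≢2n : ∀ {m} n → 1 ≤ m → 2 * m ∸ 1 ≢ 2 * n
2m∸1≢2n {m} n 1≤m eq = even≢odd m n (trans (sym (m+[n∸m]≡n (δ≤2n ≤-refl 1≤m))) (cong suc eq))

2m<2n∸1 : ∀ {m n} → m < n → 2 * m < 2 * n ∸ 1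
2m<2n∸1 {m} {n} m<n = ∸-monoˡ-≤ 1 (subst (_≤ 2 * n) (*-suc 2 m) (*-monoʳ-≤ 2 m<n))

-- cell 1 i j and cell 0 i j are the squares of D coming from the square (i , j) of λ/μ and of ν/ρ.
cell : ℕ → ℕ → ℕ → ℕ × ℕ
cell δ i j = (2 * i ∸ δ , 2 * j ∸ δ)

cell-row-bounds : ∀ {δ} i j → δ ≤ 1 → 2 * i ∸ 1 ≤ proj₁ (cell δ i j) × proj₁ (cell δ i j) ≤ 2 * i
cell-row-bounds {δ} i j δ≤1 = ∸-monoʳ-≤ (2 * i) δ≤1 , m∸n≤m (2 * i) δ

cell-stride : ∀ {la mu δ i j i' j'} → IsPartition la → IsPartition mu → δ ≤ 1 →
              InSkewShape la mu (i , j) → InSkewShape la mu (i' , j') →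
              proj₂ (cell δ i j) ≡ proj₂ (cell δ i' j') → proj₁ (cell δ i j) < proj₁ (cell δ i' j') →
              2 + proj₁ (cell δ i j) ≤ proj₁ (cell δ i' j') ×
              cell δ (suc i) j ≡ (2 + proj₁ (cell δ i j) , proj₂ (cell δ i j)) ×
              InSkewShape la mu (suc i , j)
cell-stride {la} {mu} {δ} {i} {j} {i'} isPartition-la isPartition-mu δ≤1 s@(1≤i , _) s' same-column higher
  with 2m∸δ≡2n∸δ⇒m≡n δ≤1 (InSkewShape⇒1≤col {la} {mu} s) (InSkewShape⇒1≤col {la} {mu} s') same-column
... | refl =
  subst (_≤ 2 * i' ∸ δ) 2+ (m≤n⇒2m∸δ≤2n∸δ {δ} i<i') ,
  cong (_, 2 * j ∸ δ) 2+ ,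
  InSkewShape-below {la} {mu} isPartition-la isPartition-mu s s' i<i'
  where
    i<i' : i < i'
    i<i' = 2m∸δ<2n∸δ⇒m<n {δ} higher
    2+ : 2 * suc i ∸ δ ≡ 2 + (2 * i ∸ δ)
    2+ = 2[1+n]∸δ≡2+[2n∸δ] (δ≤2n δ≤1 1≤i)

∈-colsDesc⁻ : ∀ {lo hi j} → j ∈ colsDesc lo hi → lo < j × j ≤ hi
∈-colsDesc⁻ {lo} {hi} j∈ with ∈-filter⁻ (lo <?_) {xs = map suc (downFrom hi)} j∈
... | j∈suc , lo<j with ∈-map⁻ suc j∈suc
...   | _ , j-1∈ , refl = lo<j , ∈-downFrom⁻ j-1∈

∈-colsDesc⁺ : ∀ {lo hi j} → lo < j → j ≤ hi → j ∈ colsDesc lo hi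
∈-colsDesc⁺ {lo} {j = suc j} lo<j j≤hi = ∈-filter⁺ (lo <?_) (∈-map⁺ suc (∈-downFrom⁺ j≤hi)) lo<j

colsDesc-descending : ∀ lo hi → AllPairs _>_ (colsDesc lo hi)
colsDesc-descending lo hi =
  AllPairs.filter⁺ (lo <?_) (AllPairs.map⁺ (AllPairs.applyDownFrom⁺₁ _ hi (λ j<i _ → s≤s j<i)))

rowBlock : List ℕ → List ℕ → List ℕ → List ℕ → ℕ → List (ℕ × ℕ)
rowBlock la mu nu rho i = map (cell 1 i) (colsDesc (len mu i) (len la i))
                       ++ map (cell 0 i) (colsDesc (len rho i) (len nu i))

rowBlock-row-bounds : ∀ la mu nu rho i →
                      All (λ p → 2 * i ∸ 1 ≤ proj₁ p × proj₁ p ≤ 2 * i) (rowBlock la mu nu rho i)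
rowBlock-row-bounds la mu nu rho i =
  All.++⁺ (All.map⁺ (All.universal (λ j → cell-row-bounds i j ≤-refl) (colsDesc (len mu i) (len la i))))
          (All.map⁺ (All.universal (λ j → cell-row-bounds i j z≤n) (colsDesc (len rho i) (len nu i))))

rowBlock-sorted : ∀ la mu nu rho {i} → 1 ≤ i → AllPairs Precedes (rowBlock la mu nu rho i)
rowBlock-sorted la mu nu rho {i} 1≤i =
  AllPairs.++⁺ (sameRow 1 (len mu i) (len la i)) (sameRow 0 (len rho i) (len nu i))
    (All.map⁺ (All.universal (λ _ → All.map⁺ (All.universal (λ _ → inj₁ odd<even) evenCols)) oddCols))
  where
    oddCols = colsDesc (len mu i) (len la i)
    evenCols = colsDesc (len rho i) (len nu i)
    sameRow : ∀ δ lo hi → AllPairs Precedes (map (cell δ i) (colsDesc lo hi))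
    sameRow δ lo hi = AllPairs.map⁺ {f = cell δ i}
      (AllPairs.map (λ c>c' → inj₂ (refl , m≤n⇒2m∸δ≤2n∸δ {δ} (<⇒≤ c>c'))) (colsDesc-descending lo hi))
    odd<even : 2 * i ∸ 1 < 2 * i
    odd<even = ∸-monoʳ-< z<s (δ≤2n ≤-refl 1≤i)

shuffleDiagram-sorted : ∀ la mu nu rho → AllPairs Precedes (shuffleDiagram la mu nu rho)
shuffleDiagram-sorted la mu nu rho =
  AllPairs.concat⁺
    (All.map⁺ (All.map⁺ (All.universal (λ _ → rowBlock-sorted la mu nu rho z<s) rowIndices)))
    (AllPairs.map⁺ (AllPairs.map⁺ {f = suc}
      (AllPairs.applyUpTo⁺₁ _ (length la ⊔ length nu) (λ i<i' _ → earlier-block (s≤s i<i')))))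
  where
    rowIndices = upTo (length la ⊔ length nu)
    earlier-block : ∀ {i i'} → i < i' →
                    All (λ p → All (Precedes p) (rowBlock la mu nu rho i')) (rowBlock la mu nu rho i)
    earlier-block {i} {i'} i<i' =
      All.map (λ (_ , p≤2i) →
                 All.map (λ (2i'-1≤q , _) → inj₁ (≤-<-trans p≤2i (<-≤-trans (2m<2n∸1 i<i') 2i'-1≤q)))
                         (rowBlock-row-bounds la mu nu rho i'))
              (rowBlock-row-bounds la mu nu rho i)

data InShuffle (la mu nu rho : List ℕ) : ℕ × ℕ → Set where
  odd  : ∀ {i j} → InSkewShape la mu (i , j) → InShuffle la mu nu rho (cell 1 i j)
  even : ∀ {i j} → InSkewShape nu rho (i , j) → InShuffle la mu nu rho (cell 0 i j)

∈-rowBlock⁻ : ∀ {la mu nu rho i p} → 1 ≤ i → p ∈ rowBlock la mu nu rho i → InShuffle la mu nu rho p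
∈-rowBlock⁻ {la} {mu} {i = i} 1≤i p∈ with ∈-++⁻ (map (cell 1 i) (colsDesc (len mu i) (len la i))) p∈
... | inj₁ p∈odd with ∈-map⁻ (cell 1 i) p∈odd
...   | _ , j∈ , refl = odd (1≤i , ∈-colsDesc⁻ j∈)
∈-rowBlock⁻ {i = i} 1≤i p∈ | inj₂ p∈even with ∈-map⁻ (cell 0 i) p∈even
...   | _ , j∈ , refl = even (1≤i , ∈-colsDesc⁻ j∈)

∈-shuffleDiagram⁻ : ∀ {la mu nu rho p} → p ∈ shuffleDiagram la mu nu rho → InShuffle la mu nu rho p
∈-shuffleDiagram⁻ {la} {mu} {nu} {rho} p∈
  with find (∈-concatMap⁻ (rowBlock la mu nu rho) {xs = map suc (upTo (length la ⊔ length nu))} p∈)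
... | _ , i∈ , p∈block with ∈-map⁻ suc i∈
...   | _ , _ , refl = ∈-rowBlock⁻ z<s p∈block

∈-shuffleDiagram⁺ : ∀ {la mu nu rho p} → InShuffle la mu nu rho p → p ∈ shuffleDiagram la mu nu rho
∈-shuffleDiagram⁺ {la} {mu} {nu} {rho} (odd {suc i} s@(_ , mu<j , j≤la)) =
  ∈-concatMap⁺ (rowBlock la mu nu rho) {xs = map suc (upTo (length la ⊔ length nu))}
    (lose (∈-map⁺ suc (∈-upTo⁺ (≤-trans (InSkewShape⇒≤length {la} {mu} s) (m≤m⊔n _ _))))
          (∈-++⁺ˡ (∈-map⁺ (cell 1 (suc i)) (∈-colsDesc⁺ mu<j j≤la))))
∈-shuffleDiagram⁺ {la} {mu} {nu} {rho} (even {suc i} s@(_ , rho<j , j≤nu)) =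
  ∈-concatMap⁺ (rowBlock la mu nu rho) {xs = map suc (upTo (length la ⊔ length nu))}
    (lose (∈-map⁺ suc (∈-upTo⁺ (≤-trans (InSkewShape⇒≤length {nu} {rho} s) (m≤n⊔m _ _))))
          (∈-++⁺ʳ (map (cell 1 (suc i)) (colsDesc (len mu (suc i)) (len la (suc i))))
                  (∈-map⁺ (cell 0 (suc i)) (∈-colsDesc⁺ rho<j j≤nu))))

InShuffle-stride : ∀ {la mu nu rho p q} →
                   IsPartition la → IsPartition mu → IsPartition nu → IsPartition rho →
                   InShuffle la mu nu rho p → InShuffle la mu nu rho q →
                   proj₂ p ≡ proj₂ q → proj₁ p < proj₁ q →
                   2 + proj₁ p ≤ proj₁ q × InShuffle la mu nu rho (2 + proj₁ p , proj₂ p)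
InShuffle-stride {la} {mu} {nu} {rho} isPartition-la isPartition-mu _ _ (odd s) (odd s') same higher =
  let gap , below , s'' = cell-stride {la} {mu} isPartition-la isPartition-mu ≤-refl s s' same higher
  in  gap , subst (InShuffle la mu nu rho) below (odd s'')
InShuffle-stride {la} {mu} {nu} {rho} _ _ isPartition-nu isPartition-rho (even s) (even s') same higher =
  let gap , below , s'' = cell-stride {nu} {rho} isPartition-nu isPartition-rho z≤n s s' same higher
  in  gap , subst (InShuffle la mu nu rho) below (even s'')
InShuffle-stride {la} {mu} _ _ _ _ (odd s) (even {j = j} _) same _ =
  ⊥-elim (2m∸1≢2n j (InSkewShape⇒1≤col {la} {mu} s) same)
InShuffle-stride {la} {mu} _ _ _ _ (even {j = j} _) (odd s) same _ =
  ⊥-elim (2m∸1≢2n j (InSkewShape⇒1≤col {la} {mu} s) (sym same))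

shuffleDiagram-strided : ∀ la mu nu rho →
                         IsPartition la → IsPartition mu → IsPartition nu → IsPartition rho →
                         StridedColumns (shuffleDiagram la mu nu rho)
shuffleDiagram-strided la mu nu rho isPartition-la isPartition-mu isPartition-nu isPartition-rho p∈ q∈ r<r' =
  let gap , below = InShuffle-stride isPartition-la isPartition-mu isPartition-nu isPartition-rho
                                     (∈-shuffleDiagram⁻ {la} {mu} {nu} {rho} p∈) (∈-shuffleDiagram⁻ q∈)
                                     refl r<r'
  in  gap , ∈-shuffleDiagram⁺ below

lemma2p14 : (la mu nu rho : List ℕ) → IsSkewShape la mu → IsSkewShape nu rho →
            (kappa : List ℕ) →
            (T : SYT kappa (length (shuffleDiagram la mu nu rho))) →
            Compatible (shuffleDiagram la mu nu rho) T →
            IsShuffleTableau (shuffleDiagram la mu nu rho) (φ T)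
lemma2p14 la mu nu rho (isPartition-la , isPartition-mu , _) (isPartition-nu , isPartition-rho , _)
          _ T compatible =
  compatible⇒shuffleTableau T compatible
    (shuffleDiagram-sorted la mu nu rho)
    (shuffleDiagram-strided la mu nu rho isPartition-la isPartition-mu isPartition-nu isPartition-rho)
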